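{- Let $k>2$ be an integer and let $p\in\{1,2,3\}$. Then for every positive integer $n$, $t_p(n,K_k)=e_p(T(n,k))$, where $T(n,k)$ is the Tur\'an graph.
   Context: All graphs are finite, undirected, without loops or multiple edges. For a graph $G$ with degree sequence $d_1,\ldots,d_n$ and a positive integer $p$, $e_p(G)=\sum_{i=1}^n d_i^p$. For a fixed graph $H$, $t_p(n,H)$ denotes the maximum of $e_p(G)$ over all graphs $G$ with $n$ vertices that do not contain $H$ as a subgraph. $K_k$ is the complete graph on $k$ vertices. The Tur\'an graph $T(n,k)$ is the complete $(k-1)$-partite graph on $n$ vertices whose $k-1$ vertex classes have sizes as equal as possible (any two class sizes differ by at most one); it is the extremal graph for the Tur\'an number of $K_k$. -}

module Defs where

open import Data.Bool using (Bool; true; false; if_then_else_; not)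
open import Data.Nat using (ℕ; zero; suc; _+_; _^_; _≤_; _%_; _≡ᵇ_)
open import Data.Fin using (Fin; toℕ)
open import Data.List using (List; map)
open import Data.Nat.ListAction using (sum)
open import Data.List.Base using (allFin)
open import Data.Product using (Σ; _×_)
open import Relation.Binary.PropositionalEquality using (_≡_; _≢_)
open import Function.Definitions using (Injective)
import Data.Fin
import Data.Nat.DivMod
import Relation.Binary.PropositionalEquality

record Graph (n : ℕ) : Set where
  field
    adj    : Fin n → Fin n → Bool
    sym    : ∀ i j → adj i j ≡ adj j i
    irrefl : ∀ i → adj i i ≡ false
open Graph public

degree : ∀ {n} → Graph n → Fin n → ℕ
degree {n} G i = sum (map (λ j → if adj G i j then 1 else 0) (allFin n))

e : ∀ {n} → ℕ → Graph n → ℕ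
e {n} p G = sum (map (λ i → degree G i ^ p) (allFin n))

Contains : ∀ {n m} → Graph n → Graph m → Set
Contains {n} {m} G H =
  Σ (Fin m → Fin n) λ f →
    Injective _≡_ _≡_ f × (∀ i j → adj H i j ≡ true → adj G (f i) (f j) ≡ true)

complete : (k : ℕ) → Graph k
complete k = record
  { adj = λ i j → not (toℕ i ≡ᵇ toℕ j)
  ; sym = λ i j → symEq (toℕ i) (toℕ j)
  ; irrefl = λ i → reflEq (toℕ i) }
  where
  symEq : ∀ a b → not (a ≡ᵇ b) ≡ not (b ≡ᵇ a)
  symEq zero zero = Relation.Binary.PropositionalEquality.refl
  symEq zero (suc b) = Relation.Binary.PropositionalEquality.refl
  symEq (suc a) zero = Relation.Binary.PropositionalEquality.refl
  symEq (suc a) (suc b) = symEq a b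
  reflEq : ∀ a → not (a ≡ᵇ a) ≡ false
  reflEq zero = Relation.Binary.PropositionalEquality.refl
  reflEq (suc a) = reflEq a

-- Class sizes are floor(n/r) or ceil(n/r), i.e. as equal as possible.
completeMultipartite : (n r' : ℕ) → Graph n
completeMultipartite n r' = record
  { adj = λ i j → adj (complete (suc r')) (cls i) (cls j)
  ; sym = λ i j → sym (complete (suc r')) (cls i) (cls j)
  ; irrefl = λ i → irrefl (complete (suc r')) (cls i) }
  where
  cls : Fin n → Fin (suc r')
  cls i = Data.Fin.fromℕ< (Data.Nat.DivMod.m%n<n (toℕ i) (suc r'))

emptyGraph : (n : ℕ) → Graph n
emptyGraph n = record { adj = λ _ _ → false
                      ; sym = λ _ _ → Relation.Binary.PropositionalEquality.refl
                      ; irrefl = λ _ → Relation.Binary.PropositionalEquality.refl }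

turan : (n k : ℕ) → Graph n
turan n zero = emptyGraph n
turan n (suc zero) = emptyGraph n
turan n (suc (suc r')) = completeMultipartite n r'

IsTp : ℕ → (n : ℕ) → ∀ {m} → Graph m → ℕ → Set
IsTp p n H t =
  Σ (Graph n) (λ G → (Contains G H → ⊥') × (e p G ≡ t))
  × (∀ (G : Graph n) → (Contains G H → ⊥') → e p G ≤ t)
  where
  open import Data.Empty renaming (⊥ to ⊥')

-- Erdős's degree majorisation: a K_(r+1)-free graph G has a complete r-partite graph H on
-- the same vertices with deg_G v ≤ deg_H v for every v (take x of maximum degree, recurse
-- into its neighbourhood, and put all non-neighbours of x into one new class). Hence
-- e_p(G) ≤ e_p(H) = Σ_j s_j (n − s_j)^p, summed over the class sizes s_j of H. For p ≤ 3,
-- moving one vertex from a class of size a + 1 to a class of size b ≤ a never decreases this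
-- sum; such moves strictly decrease Σ_j s_j², so they end at balanced class sizes, and all
-- balanced size vectors with sum n give the same value, namely e_p of the Turán graph.

module Submission where

open import Defs hiding (sym)
open import Data.Nat using (ℕ; _<_; _≤_)
open import Data.Sum using (_⊎_)
open import Relation.Binary.PropositionalEquality using (_≡_)

open import Data.Nat using (zero; suc; _+_; _*_; _∸_; _^_; pred; _≡ᵇ_; _<ᵇ_; _%_; z≤n; s≤s; s≤s⁻¹; z<s)
open import Data.Nat.Properties
open import Data.Nat.Induction using (<-wellFounded)
open import Data.Nat.DivMod using (m%n<n; [m+kn]%n≡m%n; m<n⇒m%n≡m)
open import Data.Nat.Tactic.RingSolver using (solve-∀)
open import Data.Nat.Solver using (module +-*-Solver)
open +-*-Solver using (solve; _:=_; _:+_; _:*_; _:^_; con)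
open import Data.Bool using (Bool; true; false; if_then_else_; not; _∧_)
open import Data.Fin using (Fin; toℕ; fromℕ; fromℕ<; punchIn; punchOut)
open import Data.Fin.Properties using (toℕ-fromℕ; toℕ-fromℕ<; toℕ-inject₁; toℕ<n; pigeonhole; any?; punchInᵢ≢i; punchIn-punchOut)
open import Data.Vec.Functional using (_∷_; removeAt; updateAt)
open import Data.Vec.Functional.Properties using (updateAt-updates; updateAt-minimal)
open import Data.List using (map; tabulate; allFin)
open import Data.List.Properties using (map-tabulate)
open import Data.List.Membership.Propositional.Properties using (∈-allFin)
import Data.List.Relation.Unary.All as All
open import Data.List.Extrema.Nat using (argmin; argmax; f[argmin]≤f[xs]; f[xs]≤f[argmax])
import Data.Nat.ListAction as List
open import Data.Product using (Σ-syntax; ∃; ∃-syntax; ∃₂; _×_; _,_; proj₁; proj₂)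
open import Data.Sum using (inj₁; inj₂; [_,_]′)
open import Function using (_∘_; const; id)
open import Function.Definitions using (Injective)
open import Induction.WellFounded using (Acc; acc)
open import Relation.Binary.PropositionalEquality using (refl; sym; trans; cong; cong₂; subst; subst₂; _≢_; ≢-sym; module ≡-Reasoning)
open import Relation.Nullary using (¬_; yes; no; contradiction)
open import Relation.Nullary.Decidable using (dec-true; dec-false)
open import Algebra.Properties.Semiring.Sum +-*-semiring
  using (sum; sum-syntax; ∑-distrib-+; ∑-comm; *-distribʳ-sum; sum-cong-≗; sum-remove; sum-init-last; sum-replicate-zero)

⟦_⟧ : Bool → ℕ
⟦ b ⟧ = if b then 1 else 0

sum-map-allFin : ∀ n (f : Fin n → ℕ) → List.sum (map f (allFin n)) ≡ ∑[ i < n ] f i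
sum-map-allFin n f = trans (cong List.sum (map-tabulate id f)) (sum-tabulate n f)
  where
  sum-tabulate : ∀ n (f : Fin n → ℕ) → List.sum (tabulate f) ≡ ∑[ i < n ] f i
  sum-tabulate zero    f = refl
  sum-tabulate (suc n) f = cong (f Fin.zero +_) (sum-tabulate n (f ∘ Fin.suc))

∑-mono-≤ : ∀ {n} {f g : Fin n → ℕ} → (∀ i → f i ≤ g i) → ∑[ i < n ] f i ≤ ∑[ i < n ] g i
∑-mono-≤ {zero}  f≤g = z≤n
∑-mono-≤ {suc n} f≤g = +-mono-≤ (f≤g Fin.zero) (∑-mono-≤ (f≤g ∘ Fin.suc))

∑-mono-< : ∀ {n} {f g : Fin n → ℕ} → (∀ i → f i ≤ g i) → ∀ j → f j < g j → ∑[ i < n ] f i < ∑[ i < n ] g i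
∑-mono-< {suc n} {f} {g} f≤g j fj<gj = begin-strict
  sum f                      ≡⟨ sum-remove {i = j} f ⟩
  f j + sum (removeAt f j)   <⟨ +-mono-<-≤ fj<gj (∑-mono-≤ (f≤g ∘ punchIn j)) ⟩
  g j + sum (removeAt g j)   ≡⟨ sum-remove {i = j} g ⟨
  sum g                      ∎
  where open ≤-Reasoning

∑-const : ∀ n c → ∑[ i < n ] c ≡ n * c
∑-const zero    c = refl
∑-const (suc n) c = cong (c +_) (∑-const n c)

∑-indicator : ∀ {n} (f : Fin n → ℕ) (i : Fin n) → ∑[ k < n ] (⟦ toℕ k ≡ᵇ toℕ i ⟧ * f k) ≡ f i
∑-indicator {suc n} f Fin.zero    = trans (cong₂ _+_ (+-identityʳ _) (sum-replicate-zero n)) (+-identityʳ _)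
∑-indicator         f (Fin.suc i) = ∑-indicator (f ∘ Fin.suc) i

term-≤-∑ : ∀ {n} (f : Fin n → ℕ) k → f k ≤ ∑[ i < n ] f i
term-≤-∑ {suc n} f k = subst (f k ≤_) (sym (sum-remove {i = k} f)) (m≤m+n (f k) _)

two-terms-≤-∑ : ∀ {n} (f : Fin n → ℕ) {i j} → i ≢ j → f i + f j ≤ ∑[ k < n ] f k
two-terms-≤-∑ {suc n} f {i} {j} i≢j = begin
  f i + f j                           ≡⟨ cong (λ k → f i + f k) (punchIn-punchOut i≢j) ⟨
  f i + removeAt f i (punchOut i≢j)   ≤⟨ +-monoʳ-≤ (f i) (term-≤-∑ (removeAt f i) (punchOut i≢j)) ⟩
  f i + sum (removeAt f i)            ≡⟨ sum-remove {i = i} f ⟨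
  sum f                               ∎
  where open ≤-Reasoning

∑-replace : ∀ {n} (f f′ : Fin n → ℕ) i → (∀ k → k ≢ i → f′ k ≡ f k) → ∑[ k < n ] f′ k + f i ≡ ∑[ k < n ] f k + f′ i
∑-replace {suc n} f f′ i agree = begin
  sum f′ + f i                              ≡⟨ cong (_+ f i) (sum-remove {i = i} f′) ⟩
  f′ i + sum (removeAt f′ i) + f i          ≡⟨ cong (λ x → f′ i + x + f i) (sum-cong-≗ {n} (λ k → agree _ (punchInᵢ≢i i k))) ⟩
  f′ i + sum (removeAt f i) + f i           ≡⟨ swap (f′ i) (sum (removeAt f i)) (f i) ⟩
  f i + sum (removeAt f i) + f′ i           ≡⟨ cong (_+ f′ i) (sum-remove {i = i} f) ⟨
  sum f + f′ i                              ∎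
  where
  open ≡-Reasoning
  swap : ∀ a x b → a + x + b ≡ b + x + a
  swap = solve-∀

∑-updateAt : ∀ {n} (h : ℕ → ℕ) (s : Fin n → ℕ) i f →
             ∑[ k < n ] h (updateAt s i f k) + h (s i) ≡ ∑[ k < n ] h (s k) + h (f (s i))
∑-updateAt {n} h s i f = trans (∑-replace (h ∘ s) (h ∘ updateAt s i f) i (λ k k≢i → cong h (updateAt-minimal k i s k≢i)))
                               (cong (λ x → ∑[ k < n ] h (s k) + h x) (updateAt-updates i s))

classSize : ∀ {n} → (Fin n → ℕ) → ℕ → ℕ
classSize {n} c a = ∑[ u < n ] ⟦ a ≡ᵇ c u ⟧

∑-by-class : ∀ {n r} (c : Fin n → ℕ) → (∀ v → c v < r) → (h : ℕ → ℕ) →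
             ∑[ v < n ] h (c v) ≡ ∑[ j < r ] (classSize c (toℕ j) * h (toℕ j))
∑-by-class {n} {r} c c<r h = begin
  ∑[ v < n ] h (c v)                                    ≡⟨ sum-cong-≗ {n} (select ∘ c<r) ⟨
  ∑[ v < n ] ∑[ j < r ] (⟦ toℕ j ≡ᵇ c v ⟧ * h (toℕ j))   ≡⟨ ∑-comm {n} {r} (λ v j → ⟦ toℕ j ≡ᵇ c v ⟧ * h (toℕ j)) ⟩
  ∑[ j < r ] ∑[ v < n ] (⟦ toℕ j ≡ᵇ c v ⟧ * h (toℕ j))   ≡⟨ sum-cong-≗ {r} (λ j → *-distribʳ-sum {n} (h (toℕ j)) _) ⟨
  ∑[ j < r ] (classSize c (toℕ j) * h (toℕ j))          ∎
  where
  open ≡-Reasoning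
  select : ∀ {a} (a<r : a < r) → ∑[ j < r ] (⟦ toℕ j ≡ᵇ a ⟧ * h (toℕ j)) ≡ h a
  select a<r = subst (λ a → ∑[ j < r ] (⟦ toℕ j ≡ᵇ a ⟧ * h (toℕ j)) ≡ h a)
                     (toℕ-fromℕ< a<r) (∑-indicator (h ∘ toℕ) (fromℕ< a<r))

∑-classSize : ∀ {n r} (c : Fin n → ℕ) → (∀ v → c v < r) → ∑[ j < r ] classSize c (toℕ j) ≡ n
∑-classSize {n} {r} c c<r = begin
  ∑[ j < r ] classSize c (toℕ j)         ≡⟨ sum-cong-≗ {r} (λ j → *-identityʳ (classSize c (toℕ j))) ⟨
  ∑[ j < r ] (classSize c (toℕ j) * 1)   ≡⟨ ∑-by-class c c<r (const 1) ⟨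
  ∑[ v < n ] 1                           ≡⟨ ∑-const n 1 ⟩
  n * 1                                  ≡⟨ *-identityʳ n ⟩
  n                                      ∎
  where open ≡-Reasoning

≡ᵇ-sym : ∀ m n → (m ≡ᵇ n) ≡ (n ≡ᵇ m)
≡ᵇ-sym zero    zero    = refl
≡ᵇ-sym zero    (suc n) = refl
≡ᵇ-sym (suc m) zero    = refl
≡ᵇ-sym (suc m) (suc n) = ≡ᵇ-sym m n

multipartite : ∀ {n} → (Fin n → ℕ) → Graph n
multipartite c = record
  { adj    = λ u v → not (c u ≡ᵇ c v)
  ; sym    = λ u v → cong not (≡ᵇ-sym (c u) (c v))
  ; irrefl = λ u → cong not (dec-true (c u ≟ c u) refl)
  }

degree-multipartite : ∀ {n} (c : Fin n → ℕ) v → degree (multipartite c) v ≡ n ∸ classSize c (c v)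
degree-multipartite {n} c v = begin
  degree (multipartite c) v  ≡⟨ sum-map-allFin n _ ⟩
  others                     ≡⟨ m+n∸n≡m others (classSize c (c v)) ⟨
  others + classSize c (c v) ∸ classSize c (c v) ≡⟨ cong (_∸ classSize c (c v)) partition ⟩
  n ∸ classSize c (c v)      ∎
  where
  open ≡-Reasoning
  others = ∑[ u < n ] ⟦ not (c v ≡ᵇ c u) ⟧
  complement : ∀ b → ⟦ not b ⟧ + ⟦ b ⟧ ≡ 1
  complement true  = refl
  complement false = refl
  partition : others + classSize c (c v) ≡ n
  partition = trans (sym (∑-distrib-+ {n} _ _))
                (trans (sum-cong-≗ (complement ∘ (c v ≡ᵇ_) ∘ c)) (trans (∑-const n 1) (*-identityʳ n)))

weight : ℕ → ℕ → ℕ → ℕ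
weight n p x = x * (n ∸ x) ^ p

e-multipartite : ∀ {n r} p (c : Fin n → ℕ) → (∀ v → c v < r) →
                 e p (multipartite c) ≡ ∑[ j < r ] weight n p (classSize c (toℕ j))
e-multipartite {n} {r} p c c<r = begin
  e p (multipartite c)                        ≡⟨ sum-map-allFin n _ ⟩
  ∑[ v < n ] (degree (multipartite c) v ^ p)  ≡⟨ sum-cong-≗ (cong (_^ p) ∘ degree-multipartite c) ⟩
  ∑[ v < n ] ((n ∸ classSize c (c v)) ^ p)    ≡⟨ ∑-by-class c c<r (λ a → (n ∸ classSize c a) ^ p) ⟩
  ∑[ j < r ] weight n p (classSize c (toℕ j))  ∎
  where open ≡-Reasoning

e-mono : ∀ {n} p {G H : Graph n} → (∀ v → degree G v ≤ degree H v) → e p G ≤ e p H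
e-mono {n} p G≤H = subst₂ _≤_ (sym (sum-map-allFin n _)) (sym (sum-map-allFin n _))
                          (∑-mono-≤ (λ v → ^-monoˡ-≤ p (G≤H v)))

multipartite-K-free : ∀ {n r} (c : Fin n → Fin r) → ¬ Contains (multipartite (toℕ ∘ c)) (complete (suc r))
multipartite-K-free c (f , _ , edge) with i , j , i<j , same ← pigeonhole (n<1+n _) (c ∘ f) =
  contradiction (trans (sym (cong not (dec-true (_ ≟ _) (cong toℕ same))))
                       (edge i j (cong not (dec-false (_ ≟ _) (<⇒≢ i<j))))) λ ()

maximiser : ∀ {m} (f : Fin (suc m) → ℕ) → ∃[ x ] ∀ v → f v ≤ f x
maximiser f = argmax f Fin.zero (allFin _) , λ v → All.lookup (f[xs]≤f[argmax] {f = f} Fin.zero (allFin _)) (∈-allFin v)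

minimiser : ∀ {m} (f : Fin (suc m) → ℕ) → ∃[ x ] ∀ v → f x ≤ f v
minimiser f = argmin f Fin.zero (allFin _) , λ v → All.lookup (f[argmin]≤f[xs] {f = f} Fin.zero (allFin _)) (∈-allFin v)

argmax-on : ∀ {n} (S : Fin n → Bool) (f : Fin n → ℕ) →
            (∀ v → S v ≡ false) ⊎ ∃[ x ] S x ≡ true × (∀ v → S v ≡ true → f v ≤ f x)
argmax-on {zero}  S f = inj₁ λ ()
argmax-on {suc n} S f = select (maximiser score)
  where
  -- score is positive exactly on S, so a maximiser of score lies in S unless S is empty.
  score : Fin (suc n) → ℕ
  score v = if S v then suc (f v) else 0
  score-at : ∀ {v b} → S v ≡ b → score v ≡ (if b then suc (f v) else 0)
  score-at {v} = cong (λ b → if b then suc (f v) else 0)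
  select : ∃[ x ] (∀ v → score v ≤ score x) →
           (∀ v → S v ≡ false) ⊎ ∃[ x ] S x ≡ true × (∀ v → S v ≡ true → f v ≤ f x)
  select (x , max) with S x in Sx
  ... | true  = inj₂ (x , Sx , λ v Sv → s≤s⁻¹ (subst (_≤ suc (f x)) (score-at Sv) (max v)))
  ... | false = inj₁ λ v → vanishes (S v) (max v)
    where
    vanishes : ∀ b {y} → (if b then suc y else 0) ≤ 0 → b ≡ false
    vanishes false _ = refl

degreeIn : ∀ {n} → Graph n → (Fin n → Bool) → Fin n → ℕ
degreeIn {n} H S v = ∑[ u < n ] ⟦ S u ∧ adj H v u ⟧

CliqueIn : ∀ {n} → Graph n → (Fin n → Bool) → ℕ → Set
CliqueIn G S m = Σ[ K ∈ Contains G (complete m) ] ∀ i → S (proj₁ K i) ≡ true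

neighboursIn : ∀ {n} → Graph n → (Fin n → Bool) → Fin n → Fin n → Bool
neighboursIn G S x u = S u ∧ adj G x u

MajorisingPartition : ∀ {n} → Graph n → (Fin n → Bool) → ℕ → (Fin n → ℕ) → Set
MajorisingPartition G S r c = ∀ v → S v ≡ true → c v < r × degreeIn G S v ≤ degreeIn (multipartite c) S v

∧-true : ∀ {a b} → a ∧ b ≡ true → a ≡ true × b ≡ true
∧-true {true} {true} _ = refl , refl

singleton-clique : ∀ {n} (G : Graph n) {S v} → S v ≡ true → CliqueIn G S 1
singleton-clique G {v = v} Sv = ((λ _ → v) , (λ { {Fin.zero} {Fin.zero} _ → refl }) , λ { Fin.zero Fin.zero () }) , λ _ → Sv

clique-cons : ∀ {n} (G : Graph n) {S x m} → S x ≡ true → CliqueIn G (neighboursIn G S x) m → CliqueIn G S (suc m)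
clique-cons G {S} {x} {m} Sx ((f , f-inj , f-edge) , f∈N) = (x ∷ f , inj , edge) , member
  where
  x∉f : ∀ i → x ≢ f i
  x∉f i x≡fi = contradiction (trans (sym (irrefl G x)) (subst (λ y → adj G x y ≡ true) (sym x≡fi) (proj₂ (∧-true (f∈N i))))) λ ()
  inj : Injective _≡_ _≡_ (x ∷ f)
  inj {Fin.zero}  {Fin.zero}  _ = refl
  inj {Fin.zero}  {Fin.suc j} e = contradiction e (x∉f j)
  inj {Fin.suc i} {Fin.zero}  e = contradiction (sym e) (x∉f i)
  inj {Fin.suc i} {Fin.suc j} e = cong Fin.suc (f-inj e)
  edge : ∀ i j → adj (complete (suc m)) i j ≡ true → adj G ((x ∷ f) i) ((x ∷ f) j) ≡ true
  edge Fin.zero    Fin.zero    ()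
  edge Fin.zero    (Fin.suc j) _ = proj₂ (∧-true (f∈N j))
  edge (Fin.suc i) Fin.zero    _ = trans (Graph.sym G (f i) x) (proj₂ (∧-true (f∈N i)))
  edge (Fin.suc i) (Fin.suc j) e = f-edge i j e
  member : ∀ i → S ((x ∷ f) i) ≡ true
  member Fin.zero    = Sx
  member (Fin.suc i) = proj₁ (∧-true (f∈N i))

module ErdősStep {n} (G : Graph n) {S : Fin n → Bool} {x : Fin n} {r : ℕ} {c′ : Fin n → ℕ}
  (x-max : ∀ v → S v ≡ true → degreeIn G S v ≤ degreeIn G S x)
  (maj : MajorisingPartition G (neighboursIn G S x) r c′) where

  N : Fin n → Bool
  N = neighboursIn G S x

  colouring : Fin n → ℕ
  colouring u = if N u then c′ u else r

  crossing : ℕ → ℕ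
  crossing a = ∑[ u < n ] ⟦ S u ∧ not (a ≡ᵇ colouring u) ⟧

  split : ∀ s a e → ⟦ s ∧ e ⟧ ≤ ⟦ (s ∧ a) ∧ e ⟧ + ⟦ s ∧ not a ⟧
  split true  true  e     = m≤m+n _ _
  split true  false true  = ≤-refl
  split true  false false = z≤n
  split false a     e     = z≤n

  merge : ∀ {a′ b} → a′ < r → ∀ s a →
          ⟦ (s ∧ a) ∧ not (a′ ≡ᵇ b) ⟧ + ⟦ s ∧ not a ⟧ ≡ ⟦ s ∧ not (a′ ≡ᵇ (if s ∧ a then b else r)) ⟧
  merge a′<r true  true  = +-identityʳ _
  merge a′<r true  false = cong (⟦_⟧ ∘ not) (sym (dec-false (_ ≟ _) (<⇒≢ a′<r)))
  merge a′<r false a     = refl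

  outside-N : ∀ u → ⟦ N u ⟧ ≡ ⟦ S u ∧ not (r ≡ᵇ colouring u) ⟧
  outside-N u with S u in Su | adj G x u in xu
  ... | true  | true  = cong (⟦_⟧ ∘ not) (sym (dec-false (_ ≟ _) (>⇒≢ (proj₁ (maj u (cong₂ _∧_ Su xu))))))
  ... | true  | false = cong (⟦_⟧ ∘ not) (sym (dec-true (r ≟ r) refl))
  ... | false | _     = refl

  -- degreeIn (multipartite colouring) S v unfolds to crossing (colouring v), and the
  -- case split on N v reduces colouring v.
  majorising : MajorisingPartition G S (suc r) colouring
  majorising v Sv with N v in Nv
  ... | true  = m<n⇒m<1+n (proj₁ (maj v Nv)) , (begin
    degreeIn G S v
      ≤⟨ ∑-mono-≤ (λ u → split (S u) (adj G x u) (adj G v u)) ⟩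
    ∑[ u < n ] (⟦ N u ∧ adj G v u ⟧ + ⟦ S u ∧ not (adj G x u) ⟧)
      ≡⟨ ∑-distrib-+ {n} _ _ ⟩
    degreeIn G N v + ∑[ u < n ] ⟦ S u ∧ not (adj G x u) ⟧
      ≤⟨ +-monoˡ-≤ _ (proj₂ (maj v Nv)) ⟩
    degreeIn (multipartite c′) N v + ∑[ u < n ] ⟦ S u ∧ not (adj G x u) ⟧
      ≡⟨ ∑-distrib-+ {n} _ _ ⟨
    ∑[ u < n ] (⟦ N u ∧ not (c′ v ≡ᵇ c′ u) ⟧ + ⟦ S u ∧ not (adj G x u) ⟧)
      ≡⟨ sum-cong-≗ {n} (λ u → merge (proj₁ (maj v Nv)) (S u) (adj G x u)) ⟩
    crossing (c′ v) ∎)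
    where open ≤-Reasoning
  ... | false = ≤-refl , (begin
    degreeIn G S v                          ≤⟨ x-max v Sv ⟩
    ∑[ u < n ] ⟦ N u ⟧                      ≡⟨ sum-cong-≗ {n} outside-N ⟩
    crossing r                              ∎)
    where open ≤-Reasoning

erdős : ∀ {n} (G : Graph n) r S → ¬ CliqueIn G S (suc r) → ∃ (MajorisingPartition G S r)
erdős G zero    S no-clique = (λ _ → 0) , λ v Sv → contradiction (singleton-clique G {S} Sv) no-clique
erdős G (suc r) S no-clique with argmax-on S (degreeIn G S)
... | inj₁ S-empty = (λ _ → 0) , λ v Sv → contradiction (trans (sym Sv) (S-empty v)) λ ()
... | inj₂ (x , Sx , x-max) with c′ , maj ← erdős G r (neighboursIn G S x) (no-clique ∘ clique-cons G Sx) =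
  _ , ErdősStep.majorising G x-max maj

degree-majorisation : ∀ {n} (G : Graph n) r → ¬ Contains G (complete (suc r)) →
                      ∃[ c ] ∀ v → c v < r × degree G v ≤ degree (multipartite c) v
degree-majorisation {n} G r K-free with c , majorising ← erdős G r (const true) (K-free ∘ proj₁) =
  c , λ v → proj₁ (majorising v refl) ,
            subst₂ _≤_ (sym (sum-map-allFin n _)) (sym (sum-map-allFin n _)) (proj₂ (majorising v refl))

TransferMonotone : ℕ → (ℕ → ℕ) → Set
TransferMonotone n g = ∀ {a b} → b ≤ a → suc a + b ≤ n → g (suc a) + g b ≤ g a + g (suc b)

Balanced : ∀ {r} → (Fin r → ℕ) → ℕ → Set
Balanced s q = (∀ k → s k ≡ q ⊎ s k ≡ suc q) × ∃[ j ] s j ≡ q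

sumOfSquares : ∀ {r} → (Fin r → ℕ) → ℕ
sumOfSquares {r} s = ∑[ k < r ] (s k * s k)

balanced-or-uneven : ∀ {r} (s : Fin (suc r) → ℕ) → ∃ (Balanced s) ⊎ ∃₂ λ i j → suc (s j) < s i
balanced-or-uneven s = around (minimiser s)
  where
  around : ∃[ j ] (∀ k → s j ≤ s k) → ∃ (Balanced s) ⊎ ∃₂ λ i j → suc (s j) < s i
  around (j , s-min) with any? (λ i → suc (s j) <? s i)
  ... | yes (i , uneven) = inj₂ (i , j , uneven)
  ... | no even          = inj₁ (s j , spread , j , refl)
    where
    spread : ∀ k → s k ≡ s j ⊎ s k ≡ suc (s j)
    spread k with m≤n⇒m<n∨m≡n (s-min k)
    ... | inj₁ sj<sk = inj₂ (≤-antisym (≮⇒≥ (even ∘ (k ,_))) sj<sk)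
    ... | inj₂ sj≡sk = inj₁ (sym sj≡sk)

transfer : ∀ {r} → (Fin r → ℕ) → Fin r → Fin r → Fin r → ℕ
transfer s i j = updateAt (updateAt s i pred) j suc

∑-transfer : ∀ {r} (s : Fin r → ℕ) {i j} → i ≢ j → ∀ h →
             ∑[ k < r ] h (transfer s i j k) + (h (s i) + h (s j))
             ≡ ∑[ k < r ] h (s k) + (h (pred (s i)) + h (suc (s j)))
∑-transfer {r} s {i} {j} i≢j h = begin
  ∑[ k < r ] h (transfer s i j k) + (h (s i) + h (s j))       ≡⟨ cong (λ x → moved + (h (s i) + h x)) s′j≡sj ⟨
  ∑[ k < r ] h (transfer s i j k) + (h (s i) + h (s′ j))      ≡⟨ shuffle moved (h (s i)) (h (s′ j)) ⟩
  ∑[ k < r ] h (transfer s i j k) + h (s′ j) + h (s i)        ≡⟨ cong (_+ h (s i)) (∑-updateAt h s′ j suc) ⟩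
  ∑[ k < r ] h (s′ k) + h (suc (s′ j)) + h (s i)              ≡⟨ shuffle′ (∑[ k < r ] h (s′ k)) (h (suc (s′ j))) (h (s i)) ⟩
  ∑[ k < r ] h (s′ k) + h (s i) + h (suc (s′ j))              ≡⟨ cong₂ _+_ (∑-updateAt h s i pred) (cong (h ∘ suc) s′j≡sj) ⟩
  ∑[ k < r ] h (s k) + h (pred (s i)) + h (suc (s j))         ≡⟨ +-assoc (∑[ k < r ] h (s k)) _ _ ⟩
  ∑[ k < r ] h (s k) + (h (pred (s i)) + h (suc (s j)))       ∎
  where
  open ≡-Reasoning
  s′ = updateAt s i pred
  moved = ∑[ k < r ] h (transfer s i j k)
  s′j≡sj : s′ j ≡ s j
  s′j≡sj = updateAt-minimal j i s (≢-sym i≢j)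
  shuffle : ∀ a b c → a + (b + c) ≡ a + c + b
  shuffle = solve-∀
  shuffle′ : ∀ a b c → a + b + c ≡ a + c + b
  shuffle′ = solve-∀

pred+suc : ∀ {a b} → 0 < a → pred a + suc b ≡ a + b
pred+suc {suc a} {b} _ = +-suc a b

squares-decrease : ∀ {a b} → suc b < a → pred a * pred a + suc b * suc b < a * a + b * b
squares-decrease {suc a} {b} (s≤s b<a) with d , refl ← m≤n⇒∃[o]m+o≡n b<a = begin-strict
  (suc b + d) * (suc b + d) + suc b * suc b
    <⟨ m<m+n _ z<s ⟩
  (suc b + d) * (suc b + d) + suc b * suc b + suc (suc (d + d))
    ≡⟨ identity b d ⟩
  suc (suc b + d) * suc (suc b + d) + b * b ∎
  where
  open ≤-Reasoning
  identity : ∀ b d → (suc b + d) * (suc b + d) + suc b * suc b + suc (suc (d + d))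
                     ≡ suc (suc b + d) * suc (suc b + d) + b * b
  identity = solve-∀

transfer-gain : ∀ {n} g → TransferMonotone n g → ∀ {a b} → suc b < a → a + b ≤ n →
                g a + g b ≤ g (pred a) + g (suc b)
transfer-gain g mono {suc a} (s≤s b<a) = mono (<⇒≤ b<a)

transfer-step : ∀ {n r} g → TransferMonotone n g → (s : Fin r → ℕ) → ∑[ k < r ] s k ≡ n →
                ∀ {i j} → suc (s j) < s i →
                ∑[ k < r ] transfer s i j k ≡ n × sumOfSquares (transfer s i j) < sumOfSquares s ×
                ∑[ k < r ] g (s k) ≤ ∑[ k < r ] g (transfer s i j k)
transfer-step {n} {r} g mono s ∑s {i} {j} uneven = ∑t , squares , gain
  where
  i≢j : i ≢ j
  i≢j refl = n≮n (s j) (<-trans (n<1+n (s j)) uneven)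
  si>0 : 0 < s i
  si>0 = <-trans z<s uneven
  ∑t : ∑[ k < r ] transfer s i j k ≡ n
  ∑t = trans (+-cancelʳ-≡ _ _ _ (trans (∑-transfer s i≢j id) (cong (sum s +_) (pred+suc si>0)))) ∑s
  squares : sumOfSquares (transfer s i j) < sumOfSquares s
  squares = +-cancelʳ-< _ _ _ (begin-strict
    sumOfSquares (transfer s i j) + (s i * s i + s j * s j)        ≡⟨ ∑-transfer s i≢j (λ x → x * x) ⟩
    sumOfSquares s + (pred (s i) * pred (s i) + suc (s j) * suc (s j)) <⟨ +-monoʳ-< (sumOfSquares s) (squares-decrease uneven) ⟩
    sumOfSquares s + (s i * s i + s j * s j)                       ∎)
    where open ≤-Reasoning
  gain : ∑[ k < r ] g (s k) ≤ ∑[ k < r ] g (transfer s i j k)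
  gain = +-cancelʳ-≤ _ _ _ (begin
    ∑[ k < r ] g (s k) + (g (s i) + g (s j))
      ≤⟨ +-monoʳ-≤ (∑[ k < r ] g (s k)) (transfer-gain g mono uneven (subst (s i + s j ≤_) ∑s (two-terms-≤-∑ s i≢j))) ⟩
    ∑[ k < r ] g (s k) + (g (pred (s i)) + g (suc (s j)))
      ≡⟨ ∑-transfer s i≢j g ⟨
    ∑[ k < r ] g (transfer s i j k) + (g (s i) + g (s j)) ∎)
    where open ≤-Reasoning

between : ∀ {x q} → x ≡ q ⊎ x ≡ suc q → q ≤ x × x ≤ suc q
between (inj₁ refl) = ≤-refl , n≤1+n _
between (inj₂ refl) = n≤1+n _ , ≤-refl

balanced-bounds : ∀ {r} {s : Fin r → ℕ} {q} → Balanced s q → r * q ≤ sum s × sum s < r * suc q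
balanced-bounds {r} {s} {q} (spread , j , sj≡q) =
  subst (_≤ sum s) (∑-const r q) (∑-mono-≤ (proj₁ ∘ between ∘ spread)) ,
  subst (sum s <_) (∑-const r (suc q)) (∑-mono-< (proj₂ ∘ between ∘ spread) j (subst (_< suc q) (sym sj≡q) (n<1+n q)))

floor-unique : ∀ {r N q q′} → r * q ≤ N → N < r * suc q → r * q′ ≤ N → N < r * suc q′ → q ≡ q′
floor-unique {r} {N} rq≤N N<rq+r rq′≤N N<rq′+r = ≤-antisym (below rq≤N N<rq′+r) (below rq′≤N N<rq+r)
  where
  below : ∀ {a b} → r * a ≤ N → N < r * suc b → a ≤ b
  below ra≤N N<rb+r = ≮⇒≥ λ b<a → <⇒≱ N<rb+r (≤-trans (*-monoʳ-≤ r b<a) ra≤N)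

∑-linear : ∀ {r} (f s : Fin r → ℕ) x c → ∑[ k < r ] (f k + (s k * x + c)) ≡ sum f + (sum s * x + r * c)
∑-linear {r} f s x c = begin
  ∑[ k < r ] (f k + (s k * x + c))             ≡⟨ ∑-distrib-+ {r} f _ ⟩
  sum f + ∑[ k < r ] (s k * x + c)             ≡⟨ cong (sum f +_) (∑-distrib-+ {r} _ _) ⟩
  sum f + (∑[ k < r ] (s k * x) + ∑[ k < r ] c) ≡⟨ cong (sum f +_) (cong₂ _+_ (sym (*-distribʳ-sum {r} x s)) (∑-const r c)) ⟩
  sum f + (sum s * x + r * c)                  ∎
  where open ≡-Reasoning

-- On {q, q + 1}, g agrees with the affine map x ↦ g q + (x − q) (g (q + 1) − g q); this is that
-- fact summed over the parts, with every term moved so that no subtraction occurs.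
∑-balanced : ∀ {r} (g : ℕ → ℕ) {s : Fin r → ℕ} {q} → (∀ k → s k ≡ q ⊎ s k ≡ suc q) →
             ∑[ k < r ] g (s k) + (sum s * g q + r * (q * g (suc q)))
             ≡ ∑[ k < r ] g q + (sum s * g (suc q) + r * (q * g q))
∑-balanced {r} g {s} {q} spread =
  trans (sym (∑-linear (g ∘ s) s (g q) (q * g (suc q))))
        (trans (sum-cong-≗ {r} pointwise) (∑-linear (const (g q)) s (g (suc q)) (q * g q)))
  where
  pointwise : ∀ k → g (s k) + (s k * g q + q * g (suc q)) ≡ g q + (s k * g (suc q) + q * g q)
  pointwise k with s k | spread k
  ... | _ | inj₁ refl = at-floor (g q) (g (suc q)) q
    where
    at-floor : ∀ A B q → A + (q * A + q * B) ≡ A + (q * B + q * A)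
    at-floor = solve-∀
  ... | _ | inj₂ refl = above-floor (g q) (g (suc q)) q
    where
    above-floor : ∀ A B q → B + (suc q * A + q * B) ≡ A + (suc q * B + q * A)
    above-floor = solve-∀

∑-balanced-cong : ∀ {r} (g : ℕ → ℕ) {s t : Fin r → ℕ} {q q′} → Balanced s q → Balanced t q′ →
                  sum s ≡ sum t → ∑[ k < r ] g (s k) ≡ ∑[ k < r ] g (t k)
∑-balanced-cong {r} g {s} {t} {q} {q′} s-bal t-bal ∑s≡∑t
  with refl ← floor-unique {r} {sum s} {q} {q′} (proj₁ (balanced-bounds s-bal)) (proj₂ (balanced-bounds s-bal))
                (subst (r * _ ≤_) (sym ∑s≡∑t) (proj₁ (balanced-bounds t-bal)))
                (subst (_< r * _) (sym ∑s≡∑t) (proj₂ (balanced-bounds t-bal))) =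
  +-cancelʳ-≡ _ _ _ (begin
    ∑[ k < r ] g (s k) + (sum s * g q + r * (q * g (suc q)))  ≡⟨ ∑-balanced g (proj₁ s-bal) ⟩
    ∑[ k < r ] g q + (sum s * g (suc q) + r * (q * g q))      ≡⟨ cong (λ S → ∑[ k < r ] g q + (S * g (suc q) + r * (q * g q))) ∑s≡∑t ⟩
    ∑[ k < r ] g q + (sum t * g (suc q) + r * (q * g q))      ≡⟨ ∑-balanced g (proj₁ t-bal) ⟨
    ∑[ k < r ] g (t k) + (sum t * g q + r * (q * g (suc q)))  ≡⟨ cong (λ S → ∑[ k < r ] g (t k) + (S * g q + r * (q * g (suc q)))) ∑s≡∑t ⟨
    ∑[ k < r ] g (t k) + (sum s * g q + r * (q * g (suc q)))  ∎)
  where open ≡-Reasoning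

balanced-maximises : ∀ {n r} g → TransferMonotone n g → ∀ {s t : Fin (suc r) → ℕ} {q} → Balanced t q →
                     sum s ≡ n → sum t ≡ n → ∑[ k < suc r ] g (s k) ≤ ∑[ k < suc r ] g (t k)
balanced-maximises {n} {r} g mono {s} {t} t-bal ∑s ∑t = go s ∑s (<-wellFounded _)
  where
  go : ∀ s → sum s ≡ n → Acc _<_ (sumOfSquares s) → ∑[ k < suc r ] g (s k) ≤ ∑[ k < suc r ] g (t k)
  go s ∑s (acc smaller) =
    [ (λ (_ , s-bal) → ≤-reflexive (∑-balanced-cong g s-bal t-bal (trans ∑s (sym ∑t))))
    , (λ (i , j , uneven) → let ∑s′ , squares , gain = transfer-step g mono s ∑s uneven
                             in ≤-trans gain (go (transfer s i j) ∑s′ (smaller squares)))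
    ]′ (balanced-or-uneven s)

-- With a = b + d and n = a + 1 + b + w, the gain of a transfer is d times a polynomial with
-- nonnegative coefficients. For p = 4 this fails (the coefficient of b³d is −4), which is where
-- the restriction p ≤ 3 comes from.
transfer-identity₁ : ∀ b d w → suc (b + d) * (b + w) ^ 1 + b * (suc (b + d) + w) ^ 1 + d * 2
                               ≡ (b + d) * suc (b + w) ^ 1 + suc b * (b + d + w) ^ 1
transfer-identity₁ = solve 3 (λ b d w →
  (con 1 :+ b :+ d) :* (b :+ w) :^ 1 :+ b :* (con 1 :+ b :+ d :+ w) :^ 1 :+ d :* con 2
  := (b :+ d) :* (con 1 :+ b :+ w) :^ 1 :+ (con 1 :+ b) :* (b :+ d :+ w) :^ 1) refl

transfer-identity₂ : ∀ b d w → suc (b + d) * (b + w) ^ 2 + b * (suc (b + d) + w) ^ 2 + d * (1 + d + 2 * b + 4 * w)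
                               ≡ (b + d) * suc (b + w) ^ 2 + suc b * (b + d + w) ^ 2
transfer-identity₂ = solve 3 (λ b d w →
  (con 1 :+ b :+ d) :* (b :+ w) :^ 2 :+ b :* (con 1 :+ b :+ d :+ w) :^ 2 :+ d :* (con 1 :+ d :+ con 2 :* b :+ con 4 :* w)
  := (b :+ d) :* (con 1 :+ b :+ w) :^ 2 :+ (con 1 :+ b) :* (b :+ d :+ w) :^ 2) refl

transfer-identity₃ : ∀ b d w → suc (b + d) * (b + w) ^ 3 + b * (suc (b + d) + w) ^ 3
                                 + d * (1 + 3 * w + 6 * w * w + 3 * d * w + d * d + 6 * b * w)
                               ≡ (b + d) * suc (b + w) ^ 3 + suc b * (b + d + w) ^ 3
transfer-identity₃ = solve 3 (λ b d w →
  (con 1 :+ b :+ d) :* (b :+ w) :^ 3 :+ b :* (con 1 :+ b :+ d :+ w) :^ 3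
    :+ d :* (con 1 :+ con 3 :* w :+ con 6 :* w :* w :+ con 3 :* d :* w :+ d :* d :+ con 6 :* b :* w)
  := (b :+ d) :* (con 1 :+ b :+ w) :^ 3 :+ (con 1 :+ b) :* (b :+ d :+ w) :^ 3) refl

transfer-inequality : ∀ {p} → p ≡ 1 ⊎ p ≡ 2 ⊎ p ≡ 3 → ∀ b d w →
  suc (b + d) * (b + w) ^ p + b * (suc (b + d) + w) ^ p ≤ (b + d) * suc (b + w) ^ p + suc b * (b + d + w) ^ p
transfer-inequality (inj₁ refl)        b d w = ≤-trans (m≤m+n _ _) (≤-reflexive (transfer-identity₁ b d w))
transfer-inequality (inj₂ (inj₁ refl)) b d w = ≤-trans (m≤m+n _ _) (≤-reflexive (transfer-identity₂ b d w))
transfer-inequality (inj₂ (inj₂ refl)) b d w = ≤-trans (m≤m+n _ _) (≤-reflexive (transfer-identity₃ b d w))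

weight-transfer-monotone : ∀ n {p} → p ≡ 1 ⊎ p ≡ 2 ⊎ p ≡ 3 → TransferMonotone n (weight n p)
weight-transfer-monotone n {p} p≤3 {a} {b} b≤a fits
  with d , refl ← m≤n⇒∃[o]m+o≡n b≤a
  with w , refl ← m≤n⇒∃[o]m+o≡n fits = begin
    weight n p (suc (b + d)) + weight n p b
      ≡⟨ cong₂ _+_ (cong (λ y → suc (b + d) * y ^ p) (∸-from-+ (suc (b + d)) (split₁ b d w)))
                   (cong (λ y → b * y ^ p) (∸-from-+ b (split₂ b d w))) ⟩
    suc (b + d) * (b + w) ^ p + b * (suc (b + d) + w) ^ p
      ≤⟨ transfer-inequality p≤3 b d w ⟩
    (b + d) * suc (b + w) ^ p + suc b * (b + d + w) ^ p
      ≡⟨ cong₂ _+_ (cong (λ y → (b + d) * y ^ p) (∸-from-+ (b + d) (split₃ b d w)))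
                   (cong (λ y → suc b * y ^ p) (∸-from-+ (suc b) (split₄ b d w))) ⟨
    weight n p (b + d) + weight n p (suc b) ∎
  where
  open ≤-Reasoning
  ∸-from-+ : ∀ x {y z} → x + y ≡ z → z ∸ x ≡ y
  ∸-from-+ x {y} refl = m+n∸m≡n x y
  split₁ : ∀ b d w → suc (b + d) + (b + w) ≡ suc (b + d) + b + w
  split₁ = solve-∀
  split₂ : ∀ b d w → b + (suc (b + d) + w) ≡ suc (b + d) + b + w
  split₂ = solve-∀
  split₃ : ∀ b d w → b + d + suc (b + w) ≡ suc (b + d) + b + w
  split₃ = solve-∀
  split₄ : ∀ b d w → suc b + (b + d + w) ≡ suc (b + d) + b + w
  split₄ = solve-∀

turánClass : ∀ {n} r′ → Fin n → Fin (suc r′)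
turánClass r′ u = fromℕ< (m%n<n (toℕ u) (suc r′))

∑-snoc : ∀ N (F : ℕ → ℕ) → ∑[ u < suc N ] F (toℕ u) ≡ ∑[ u < N ] F (toℕ u) + F N
∑-snoc N F = trans (sum-init-last (F ∘ toℕ)) (cong₂ _+_ (sum-cong-≗ {N} (cong F ∘ toℕ-inject₁)) (cong F (toℕ-fromℕ N)))

<ᵇ-suc : ∀ a m → ⟦ a <ᵇ m ⟧ + ⟦ a ≡ᵇ m ⟧ ≡ ⟦ a <ᵇ suc m ⟧
<ᵇ-suc zero    zero    = refl
<ᵇ-suc zero    (suc m) = refl
<ᵇ-suc (suc a) zero    = refl
<ᵇ-suc (suc a) (suc m) = <ᵇ-suc a m


residue-step : ∀ r′ {N q m} → N ≡ m + q * suc r′ → m < suc r′ →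
               (∀ (j : Fin (suc r′)) → ∑[ u < N ] ⟦ toℕ j ≡ᵇ toℕ u % suc r′ ⟧ ≡ q + ⟦ toℕ j <ᵇ m ⟧) →
               ∀ (j : Fin (suc r′)) → ∑[ u < suc N ] ⟦ toℕ j ≡ᵇ toℕ u % suc r′ ⟧ ≡ q + ⟦ toℕ j <ᵇ suc m ⟧
residue-step r′ {N} {q} {m} N≡ m<r count j = begin
  ∑[ u < suc N ] ⟦ toℕ j ≡ᵇ toℕ u % suc r′ ⟧                   ≡⟨ ∑-snoc N (λ x → ⟦ toℕ j ≡ᵇ x % suc r′ ⟧) ⟩
  ∑[ u < N ] ⟦ toℕ j ≡ᵇ toℕ u % suc r′ ⟧ + ⟦ toℕ j ≡ᵇ N % suc r′ ⟧ ≡⟨ cong₂ _+_ (count j) (cong (λ y → ⟦ toℕ j ≡ᵇ y ⟧) N%r≡m) ⟩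
  q + ⟦ toℕ j <ᵇ m ⟧ + ⟦ toℕ j ≡ᵇ m ⟧                           ≡⟨ +-assoc q _ _ ⟩
  q + (⟦ toℕ j <ᵇ m ⟧ + ⟦ toℕ j ≡ᵇ m ⟧)                         ≡⟨ cong (q +_) (<ᵇ-suc (toℕ j) m) ⟩
  q + ⟦ toℕ j <ᵇ suc m ⟧                                       ∎
  where
  open ≡-Reasoning
  N%r≡m : N % suc r′ ≡ m
  N%r≡m = trans (cong (_% suc r′) N≡) (trans ([m+kn]%n≡m%n m q (suc r′)) (m<n⇒m%n≡m m<r))

residue-count : ∀ r′ N → ∃₂ λ q m → m < suc r′ × N ≡ m + q * suc r′ ×
                ∀ (j : Fin (suc r′)) → ∑[ u < N ] ⟦ toℕ j ≡ᵇ toℕ u % suc r′ ⟧ ≡ q + ⟦ toℕ j <ᵇ m ⟧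
residue-count r′ zero    = 0 , 0 , z<s , refl , λ _ → refl
residue-count r′ (suc N) with q , m , m<r , N≡ , count ← residue-count r′ N with m≤n⇒m<n∨m≡n m<r
... | inj₁ 1+m<r = q , suc m , 1+m<r , cong suc N≡ , residue-step r′ N≡ m<r count
... | inj₂ 1+m≡r = suc q , 0 , z<s , trans (cong suc N≡) (cong (_+ q * suc r′) 1+m≡r) , wrap
  where
  wrap : ∀ (j : Fin (suc r′)) → ∑[ u < suc N ] ⟦ toℕ j ≡ᵇ toℕ u % suc r′ ⟧ ≡ suc q + 0
  wrap j = begin
    ∑[ u < suc N ] ⟦ toℕ j ≡ᵇ toℕ u % suc r′ ⟧ ≡⟨ residue-step r′ N≡ m<r count j ⟩
    q + ⟦ toℕ j <ᵇ suc m ⟧                    ≡⟨ cong (λ y → q + ⟦ toℕ j <ᵇ y ⟧) 1+m≡r ⟩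
    q + ⟦ toℕ j <ᵇ suc r′ ⟧                   ≡⟨ cong (λ b → q + ⟦ b ⟧) (dec-true (toℕ j <? suc r′) (toℕ<n j)) ⟩
    q + 1                                     ≡⟨ +-comm q 1 ⟩
    suc q                                     ≡⟨ +-identityʳ (suc q) ⟨
    suc q + 0                                 ∎
    where open ≡-Reasoning

turán-balanced : ∀ n r′ → ∃ (Balanced (λ j → classSize (toℕ ∘ turánClass {n} r′) (toℕ j)))
turán-balanced n r′ with q , m , m<r , _ , count ← residue-count r′ n = q , spread , fromℕ r′ , last-class
  where
  size : Fin (suc r′) → ℕ
  size j = classSize (toℕ ∘ turánClass {n} r′) (toℕ j)
  size≡ : ∀ j → size j ≡ q + ⟦ toℕ j <ᵇ m ⟧
  size≡ j = trans (sum-cong-≗ {n} (λ u → cong (λ y → ⟦ toℕ j ≡ᵇ y ⟧) (toℕ-fromℕ< (m%n<n (toℕ u) (suc r′))))) (count j)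
  plus-bit : ∀ b {x} → x ≡ q + ⟦ b ⟧ → x ≡ q ⊎ x ≡ suc q
  plus-bit false x≡ = inj₁ (trans x≡ (+-identityʳ q))
  plus-bit true  x≡ = inj₂ (trans x≡ (+-comm q 1))
  spread : ∀ j → size j ≡ q ⊎ size j ≡ suc q
  spread j = plus-bit (toℕ j <ᵇ m) (size≡ j)
  last-class : size (fromℕ r′) ≡ q
  last-class = trans (size≡ (fromℕ r′)) (trans (cong (λ b → q + ⟦ b ⟧) (dec-false (_ <? m) last≮m)) (+-identityʳ q))
    where
    last≮m : ¬ toℕ (fromℕ r′) < m
    last≮m lt = <⇒≱ lt (subst (m ≤_) (sym (toℕ-fromℕ r′)) (s≤s⁻¹ m<r))

turán-maximal : ∀ {n} r′ {p} → p ≡ 1 ⊎ p ≡ 2 ⊎ p ≡ 3 → (G : Graph n) → ¬ Contains G (complete (suc (suc r′))) →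
                e p G ≤ e p (completeMultipartite n r′)
turán-maximal {n} r′ {p} p≤3 G K-free
  with c , majorised ← degree-majorisation G (suc r′) K-free
  with q , turán-bal ← turán-balanced n r′ = begin
  e p G                                                    ≤⟨ e-mono p {G} {multipartite c} (proj₂ ∘ majorised) ⟩
  e p (multipartite c)                                     ≡⟨ e-multipartite p c (proj₁ ∘ majorised) ⟩
  ∑[ j < suc r′ ] weight n p (classSize c (toℕ j))         ≤⟨ balanced-maximises (weight n p) (weight-transfer-monotone n p≤3)
                                                                {s = classSize c ∘ toℕ} turán-bal
                                                                (∑-classSize c (proj₁ ∘ majorised))
                                                                (∑-classSize turán (toℕ<n ∘ turánClass r′)) ⟩
  ∑[ j < suc r′ ] weight n p (classSize turán (toℕ j))     ≡⟨ e-multipartite p turán (toℕ<n ∘ turánClass r′) ⟨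
  e p (completeMultipartite n r′)                          ∎
  where
  open ≤-Reasoning
  turán : Fin n → ℕ
  turán = toℕ ∘ turánClass r′

theorem1p1 : (k p n : ℕ) → 2 < k → (p ≡ 1 ⊎ p ≡ 2 ⊎ p ≡ 3) → 1 ≤ n →
    IsTp p n (complete k) (e p (turan n k))
-- The argument covers every k ≥ 2 and every n.
theorem1p1 (suc zero)      p n (s≤s ()) _   _
theorem1p1 (suc (suc r′)) p n _        p≤3 _ =
  (completeMultipartite n r′ , multipartite-K-free (turánClass r′) , refl) , turán-maximal r′ p≤3
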